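{- Let $w\in S_n$, let $v\subseteq w$ be a subword of size $m$ with positions $s_1<\cdots<s_m$ and entries $t_1<\cdots<t_m$, and set $u:=\mathrm{perm}(v)\in S_m$. For every $B\in \mathrm{BPD}(w;v)$, the $m\times m$ diagram $\varphi_v^w(B)$ defined by $\varphi_v^w(B)_{i,j}=B_{s_i,t_j}$ ($1\le i,j\le m$) is a minimal bumpless pipe dream with permutation $u$, i.e. $\varphi_v^w(B)\in \mathrm{mBPD}(u)$.
   Context: Permutations are written in one-line notation. A bumpless pipe dream (BPD) of size $n$ is a tiling of the $n\times n$ grid (rows $1,\dots,n$ from top to bottom, columns $1,\dots,n$ from left to right; $(i,j)$ is the cell in row $i$, column $j$, and $B_{i,j}$ its tile) by six tiles: blank (no pipe), cross (a vertical and a horizontal pipe segment crossing), horizontal segment, vertical segment, r-elbow (a turn joining the south edge of the cell to its east edge) and j-elbow (a turn joining the west edge to the north edge), such that the segments form exactly $n$ pipes, each moving only north and east, each entering through the bottom of one column and exiting through the right end of one row, with exactly one pipe per column and one per row. A pipe entering in column $j$ and exiting in row $i$ is denoted $j\rightarrow i$. The permutation $w_B$ of $B$ is given by $w_B(i)=j$ whenever $j\rightarrow i$ is a pipe; $\mathrm{BPD}(w)$ is the set of BPDs with permutation $w$. Two pipes may share several cross tiles. A pipe $j\rightarrow i$ is removable if the tile at $(i,j)$ is an r-elbow and it is the only r-elbow in row $i$ and the only r-elbow in column $j$. A BPD is minimal if it has no removable pipes; $\mathrm{mBPD}(u)$ is the set of minimal BPDs with permutation $u$ (the empty BPD of size $0$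 is the unique element of $\mathrm{mBPD}$ of the empty permutation). A subword $v\subseteq w$ of $w\in S_n$ is a subsequence $w(s_1)w(s_2)\cdots w(s_m)$ of the one-line notation with $s_1<\cdots<s_m$; $\mathrm{perm}(v)\in S_m$ is its standardization (the permutation whose entries are in the same relative order as those of $v$). $\mathrm{BPD}(w;v)$ is the set of $B\in\mathrm{BPD}(w)$ whose set of removable pipes is exactly $\{w(x)\rightarrow x : x\notin\{s_1,\dots,s_m\}\}$. (Equivalently, $\varphi_v^w(B)$ is obtained from $B$ by erasing its removable pipes and deleting their rows and columns.) -}

module Defs where

open import Data.Nat using (ℕ; zero; suc; _+_; _*_; _<_; _≟_; _<?_)
open import Data.Fin using (Fin; toℕ; fromℕ<)
open import Data.Bool using (Bool; true; false)
open import Data.Maybe using (Maybe; just; nothing)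
open import Data.Product using (_×_; ∃; ∃-syntax)
open import Data.List using (List; length; filter; allFin)
open import Function using (_⇔_)
open import Relation.Nullary using (¬_; yes; no)
open import Relation.Binary.PropositionalEquality using (_≡_; _≢_)

-- Tiles.  Indices are 0-based: Fin n stands for {1,…,n}, with row 0 the
-- top row and column 0 the leftmost column.

data Tile : Set where
  blank cross hor ver rel jel : Tile
-- hor = horizontal segment, ver = vertical segment,
-- rel = r-elbow (south edge ↔ east edge), jel = j-elbow (west ↔ north)

N S E W : Tile → Bool
N cross = true
N ver   = true
N jel   = true
N _     = false
S cross = true
S ver   = true
S rel   = true
S _     = false
E cross = true
E hor   = true
E rel   = true
E _     = false
W cross = true
W hor   = true
W jel   = true
W _     = false

Grid : ℕ → Set
Grid n = Fin n → Fin n → Tile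

-- A tiling is a valid BPD tiling: segments match across shared edges,
-- nothing enters through the left or top boundary, every column has a
-- pipe entering at the bottom and every row a pipe exiting on the right.
-- (Since all tiles route pipes north/east, this is exactly the condition
-- that the segments form n pipes, one entering per column, one exiting
-- per row.)
record IsBPD (n : ℕ) (B : Grid n) : Set where
  field
    horiz  : ∀ i j j′ → toℕ j′ ≡ suc (toℕ j) → E (B i j) ≡ W (B i j′)
    vert   : ∀ i i′ j → toℕ i′ ≡ suc (toℕ i) → S (B i j) ≡ N (B i′ j)
    left   : ∀ i j → toℕ j ≡ 0 → W (B i j) ≡ false
    top    : ∀ i j → toℕ i ≡ 0 → N (B i j) ≡ false
    bottom : ∀ i j → suc (toℕ i) ≡ n → S (B i j) ≡ true
    right  : ∀ i j → suc (toℕ j) ≡ n → E (B i j) ≡ true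

-- tile lookup with ℕ coordinates (blank outside the grid)
tileAt : ∀ {n} → Grid n → ℕ → ℕ → Tile
tileAt {n} B i j with i <? n | j <? n
... | yes p | yes q = B (fromℕ< p) (fromℕ< q)
... | _     | _     = blank

-- Following a pipe.  State: cell (i , j) and whether the pipe enters it
-- from the south (true) or from the west (false).  Returns the row
-- through whose right end the pipe exits.
data Dir : Set where
  north east stop : Dir

exitDir : Bool → Tile → Dir
exitDir true  cross = north
exitDir true  ver   = north
exitDir true  rel   = east
exitDir false cross = east
exitDir false hor   = east
exitDir false jel   = north
exitDir _     _     = stop

follow : ∀ {n} → Grid n → ℕ → ℕ → ℕ → Bool → Maybe ℕ
follow B zero i j fromS = nothing
follow {n} B (suc fuel) i j fromS with exitDir fromS (tileAt B i j)
... | stop  = nothing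
... | north with i
...   | zero   = nothing
...   | suc i′ = follow B fuel i′ j true
follow {n} B (suc fuel) i j fromS | east with suc j ≟ n
...   | yes _ = just i
...   | no  _ = follow B fuel i (suc j) false

exitRow : ∀ {n} → Grid n → ℕ → Maybe ℕ
exitRow {zero}  B j = nothing
exitRow {suc n} B j = follow B (2 * suc n + 1) n j true

HasPerm : ∀ {n} → Grid n → (Fin n → Fin n) → Set
HasPerm B w = ∀ i → exitRow B (toℕ (w i)) ≡ just (toℕ i)

InBPD : ∀ {n} → (Fin n → Fin n) → Grid n → Set
InBPD {n} w B = IsBPD n B × HasPerm B w

Removable : ∀ {n} → Grid n → (Fin n → Fin n) → Fin n → Set
Removable B w i =
  B i (w i) ≡ rel
  × (∀ j → B i j ≡ rel → j ≡ w i)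
  × (∀ i′ → B i′ (w i) ≡ rel → i′ ≡ i)

InMBPD : ∀ {m} → (Fin m → Fin m) → Grid m → Set
InMBPD u C = InBPD u C × (∀ i → ¬ Removable C u i)

StrictlyIncreasing : ∀ {m n} → (Fin m → Fin n) → Set
StrictlyIncreasing f = ∀ a b → toℕ a < toℕ b → toℕ (f a) < toℕ (f b)

InBPDsub : ∀ {m n} → (Fin n → Fin n) → (Fin m → Fin n) → Grid n → Set
InBPDsub w s B =
  InBPD w B × (∀ x → Removable B w x ⇔ (∀ k → s k ≢ x))

rank : ∀ {m} → (Fin m → ℕ) → Fin m → ℕ
rank {m} v k = length (filter (λ l → v l <? v k) (allFin m))

IsPermOf : ∀ {m} → (Fin m → ℕ) → (Fin m → Fin m) → Set
IsPermOf v u = ∀ k → toℕ (u k) ≡ rank v k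

φ : ∀ {m n} → (Fin m → Fin n) → (Fin m → Fin n) → Grid n → Grid m
φ s t B i j = B (s i) (t j)

-- A row x of B outside the subword carries a removable pipe, so its only r-elbow is at column w(x),
-- and that column has no other r-elbow.  Above that elbow no pipe can come down from the top edge,
-- below it a pipe must come up from the bottom edge, so every other tile of the column is blank, a
-- cross or a straight segment; by transposition the same holds along the row.  Pipes therefore
-- run straight through the deleted rows and columns: the kept tiles still match along their edges
-- and the boundary, and each stretch of a pipe of B between two kept cells is a single step of a
-- pipe of φ(B).  The pipe of B exiting in row s_k enters in column w(s_k) = t_(σ k), so φ(B) has
-- permutation σ, which is perm(v) since t is increasing.  A removable pipe of φ(B) would make the
-- pipe of B in the kept row s_k removable, because any other r-elbow in that row or column of B
-- would lie in a deleted column or row, whose only r-elbow is on its own deleted pipe.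

module Submission where

open import Defs
open import Data.Bool using (Bool; true; false; if_then_else_)
open import Data.Empty using (⊥-elim)
open import Data.Fin using (Fin; zero; suc; toℕ; fromℕ; fromℕ<; inject₁; punchOut)
open import Data.Fin.Permutation using (Permutation′; permutation; _⟨$⟩ʳ_)
open import Data.Fin.Properties
  using (toℕ<n; toℕ-injective; toℕ-fromℕ; toℕ-fromℕ<; fromℕ<-toℕ; toℕ-inject₁; any?;
         punchOut-injective; injective⇒≤)
  renaming (_≟_ to _≟ᶠ_)
open import Data.List using (length; filter; tabulate)
open import Data.Maybe using (just; nothing)
open import Data.Maybe.Properties using (just-injective)
open import Data.Nat using (ℕ; zero; suc; _+_; _*_; _∸_; _≤_; _<_; z≤n; s≤s; _≟_; _<?_)
open import Data.Nat.Properties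
open import Algebra.Properties.CommutativeMonoid.Sum +-0-commutativeMonoid
  using (sum; sum-permute; sum-cong-≗; sum-replicate-zero)
open import Data.Product using (_×_; _,_; proj₁; proj₂; ∃-syntax; Σ-syntax)
open import Data.Sum using (_⊎_; inj₁; inj₂)
open import Function using (id; _∘_)
open import Function.Bundles using (Equivalence)
open import Function.Definitions using (Injective)
open import Relation.Binary using (tri<; tri≈; tri>)
open import Relation.Binary.PropositionalEquality
open import Relation.Nullary using (¬_; Dec; does; yes; no; contradiction)
open import Relation.Unary using (Decidable)

-- Tiles

data Straight : Tile → Set where
  blank : Straight blank
  cross : Straight cross
  hor   : Straight hor
  ver   : Straight ver

straight-N≡S : ∀ {t} → Straight t → N t ≡ S t
straight-N≡S blank = refl
straight-N≡S cross = refl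
straight-N≡S hor   = refl
straight-N≡S ver   = refl

straight-E≡W : ∀ {t} → Straight t → E t ≡ W t
straight-E≡W blank = refl
straight-E≡W cross = refl
straight-E≡W hor   = refl
straight-E≡W ver   = refl

forward : Bool → Dir
forward true  = north
forward false = east

straight-exit : ∀ {t} → Straight t → ∀ d → exitDir d t ≡ forward d ⊎ exitDir d t ≡ stop
straight-exit blank true  = inj₂ refl
straight-exit blank false = inj₂ refl
straight-exit cross true  = inj₁ refl
straight-exit cross false = inj₁ refl
straight-exit hor   true  = inj₂ refl
straight-exit hor   false = inj₁ refl
straight-exit ver   true  = inj₁ refl
straight-exit ver   false = inj₂ refl

N≡false⇒S≡false : ∀ t → t ≢ rel → N t ≡ false → S t ≡ false
N≡false⇒S≡false blank _ _  = refl
N≡false⇒S≡false hor   _ _  = refl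
N≡false⇒S≡false jel   _ _  = refl
N≡false⇒S≡false rel   r _  = contradiction refl r
N≡false⇒S≡false cross _ ()
N≡false⇒S≡false ver   _ ()

S≡true⇒N≡true : ∀ t → t ≢ rel → S t ≡ true → N t ≡ true
S≡true⇒N≡true cross _ _  = refl
S≡true⇒N≡true ver   _ _  = refl
S≡true⇒N≡true rel   r _  = contradiction refl r
S≡true⇒N≡true blank _ ()
S≡true⇒N≡true hor   _ ()
S≡true⇒N≡true jel   _ ()

N≡false⇒straight : ∀ t → t ≢ rel → N t ≡ false → Straight t
N≡false⇒straight blank _ _  = blank
N≡false⇒straight hor   _ _  = hor
N≡false⇒straight rel   r _  = contradiction refl r
N≡false⇒straight cross _ ()
N≡false⇒straight ver   _ ()
N≡false⇒straight jel   _ ()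

S≡true⇒straight : ∀ t → t ≢ rel → S t ≡ true → Straight t
S≡true⇒straight cross _ _  = cross
S≡true⇒straight ver   _ _  = ver
S≡true⇒straight rel   r _  = contradiction refl r
S≡true⇒straight blank _ ()
S≡true⇒straight hor   _ ()
S≡true⇒straight jel   _ ()

transposeTile : Tile → Tile
transposeTile hor = ver
transposeTile ver = hor
transposeTile t   = t

N-transposeTile : ∀ t → N (transposeTile t) ≡ W t
N-transposeTile = λ { blank → refl ; cross → refl ; hor → refl ; ver → refl ; rel → refl ; jel → refl }

S-transposeTile : ∀ t → S (transposeTile t) ≡ E t
S-transposeTile = λ { blank → refl ; cross → refl ; hor → refl ; ver → refl ; rel → refl ; jel → refl }

E-transposeTile : ∀ t → E (transposeTile t) ≡ S t
E-transposeTile = λ { blank → refl ; cross → refl ; hor → refl ; ver → refl ; rel → refl ; jel → refl }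

W-transposeTile : ∀ t → W (transposeTile t) ≡ N t
W-transposeTile = λ { blank → refl ; cross → refl ; hor → refl ; ver → refl ; rel → refl ; jel → refl }

transposeTile-rel : ∀ t → transposeTile t ≡ rel → t ≡ rel
transposeTile-rel rel refl = refl
transposeTile-rel blank ()
transposeTile-rel cross ()
transposeTile-rel hor   ()
transposeTile-rel ver   ()
transposeTile-rel jel   ()

straight-transposeTile : ∀ {t} → Straight t → Straight (transposeTile t)
straight-transposeTile blank = blank
straight-transposeTile cross = cross
straight-transposeTile hor   = ver
straight-transposeTile ver   = hor

straight-transposeTile⁻ : ∀ t → Straight (transposeTile t) → Straight t
straight-transposeTile⁻ blank blank = blank
straight-transposeTile⁻ cross cross = cross
straight-transposeTile⁻ hor   ver   = hor
straight-transposeTile⁻ ver   hor   = ver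

-- Tilings indexed by natural numbers

downward-induction : ∀ {p} (P : ℕ → Set p) {n} →
                     (∀ {r} → suc r ≡ n → P r) →
                     (∀ {r} → suc r < n → P (suc r) → P r) →
                     ∀ {r} → r < n → P r
downward-induction P {n} last step {r} r<n = go (n ∸ suc r) (m+[n∸m]≡n r<n)
  where
  go : ∀ k {r} → suc r + k ≡ n → P r
  go zero    {r} e = last (trans (sym (+-identityʳ (suc r))) e)
  go (suc k) {r} e = step (subst (suc (suc r) ≤_) e′ (m≤m+n (suc (suc r)) k)) (go k e′)
    where
    e′ : suc (suc r) + k ≡ n
    e′ = trans (sym (+-suc (suc r) k)) e

record IsTiling (n : ℕ) (T : ℕ → ℕ → Tile) : Set where
  field
    east-west   : ∀ i j → i < n → suc j < n → E (T i j) ≡ W (T i (suc j))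
    south-north : ∀ i j → suc i < n → j < n → S (T i j) ≡ N (T (suc i) j)
    left-edge   : ∀ i → i < n → W (T i 0) ≡ false
    top-edge    : ∀ j → j < n → N (T 0 j) ≡ false
    bottom-edge : ∀ i j → suc i ≡ n → j < n → S (T i j) ≡ true
    right-edge  : ∀ i j → suc j ≡ n → i < n → E (T i j) ≡ true

transpose : ∀ {n T} → IsTiling n T → IsTiling n (λ i j → transposeTile (T j i))
transpose {n} {T} L = record
  { east-west   = λ i j i<n j+1<n → trans (E-transposeTile (T j i))
                    (trans (south-north j i j+1<n i<n) (sym (W-transposeTile (T (suc j) i))))
  ; south-north = λ i j i+1<n j<n → trans (S-transposeTile (T j i))
                    (trans (east-west j i j<n i+1<n) (sym (N-transposeTile (T j (suc i)))))
  ; left-edge   = λ i i<n → trans (W-transposeTile (T 0 i)) (top-edge i i<n)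
  ; top-edge    = λ j j<n → trans (N-transposeTile (T j 0)) (left-edge j j<n)
  ; bottom-edge = λ i j e j<n → trans (S-transposeTile (T j i)) (right-edge j i e j<n)
  ; right-edge  = λ i j e i<n → trans (E-transposeTile (T j i)) (bottom-edge j i e i<n)
  }
  where open IsTiling L

module TilingLemmas {n T} (L : IsTiling n T) where
  open IsTiling L

  W-along-straight : ∀ {R c₁} c₂ → R < n → c₁ ≤ c₂ → c₂ < n →
                     (∀ c → c₁ ≤ c → c < c₂ → Straight (T R c)) → W (T R c₁) ≡ W (T R c₂)
  W-along-straight zero _ z≤n _ _ = refl
  W-along-straight {R} {c₁} (suc c₂) R<n c₁≤ c₂+1<n st with m≤n⇒m<n∨m≡n c₁≤
  ... | inj₂ refl = refl
  ... | inj₁ (s≤s c₁≤c₂) = begin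
    W (T R c₁)        ≡⟨ W-along-straight c₂ R<n c₁≤c₂ (<-trans (n<1+n c₂) c₂+1<n)
                           (λ c lo hi → st c lo (m<n⇒m<1+n hi)) ⟩
    W (T R c₂)        ≡⟨ sym (straight-E≡W (st c₂ c₁≤c₂ (n<1+n c₂))) ⟩
    E (T R c₂)        ≡⟨ east-west R c₂ R<n c₂+1<n ⟩
    W (T R (suc c₂))  ∎
    where open ≡-Reasoning

  S≡true-below-straight : ∀ {R c} → R < n → c < n → (∀ r → R < r → r < n → Straight (T r c)) →
                          S (T R c) ≡ true
  S≡true-below-straight {c = c} R<n c<n =
    downward-induction (λ R → (∀ r → R < r → r < n → Straight (T r c)) → S (T R c) ≡ true)
      (λ R+1≡n _ → bottom-edge _ c R+1≡n c<n)
      (λ {R} R+1<n below st → begin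
          S (T R c)        ≡⟨ south-north R c R+1<n c<n ⟩
          N (T (suc R) c)  ≡⟨ straight-N≡S (st (suc R) ≤-refl R+1<n) ⟩
          S (T (suc R) c)  ≡⟨ below (λ r lo hi → st r (<-trans (n<1+n R) lo) hi) ⟩
          true             ∎)
      R<n
    where open ≡-Reasoning

  module _ {j X} (j<n : j < n) (rel-only-at-X : ∀ r → r < n → r ≢ X → T r j ≢ rel) where

    N≡false-above-rel : ∀ r → r ≤ X → r < n → N (T r j) ≡ false
    N≡false-above-rel zero    _     _     = top-edge j j<n
    N≡false-above-rel (suc r) r+1≤X r+1<n =
      trans (sym (south-north r j r+1<n j<n))
        (N≡false⇒S≡false (T r j) (rel-only-at-X r r<n (<⇒≢ r+1≤X))
          (N≡false-above-rel r (<⇒≤ r+1≤X) r<n))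
      where
      r<n : r < n
      r<n = <-trans (n<1+n r) r+1<n

    S≡true-below-rel : ∀ {r} → r < n → X < r → S (T r j) ≡ true
    S≡true-below-rel = downward-induction (λ r → X < r → S (T r j) ≡ true)
      (λ r+1≡n _ → bottom-edge _ j r+1≡n j<n)
      (λ {r} r+1<n below X<r → trans (south-north r j r+1<n j<n)
          (S≡true⇒N≡true (T (suc r) j) (rel-only-at-X (suc r) r+1<n (>⇒≢ (m<n⇒m<1+n X<r)))
            (below (m<n⇒m<1+n X<r))))

    straight-in-column : ∀ {r} → r < n → r ≢ X → Straight (T r j)
    straight-in-column {r} r<n r≢X with <-cmp r X
    ... | tri< r<X _ _ = N≡false⇒straight (T r j) (rel-only-at-X r r<n r≢X)
                           (N≡false-above-rel r (<⇒≤ r<X) r<n)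
    ... | tri≈ _ r≡X _ = contradiction r≡X r≢X
    ... | tri> _ _ X<r = S≡true⇒straight (T r j) (rel-only-at-X r r<n r≢X) (S≡true-below-rel r<n X<r)

module Tiling {n T} (L : IsTiling n T) where
  open TilingLemmas L public
  private module Transposed = TilingLemmas (transpose L)

  N-along-straight : ∀ {C r₁} r₂ → C < n → r₁ ≤ r₂ → r₂ < n →
                     (∀ r → r₁ ≤ r → r < r₂ → Straight (T r C)) → N (T r₁ C) ≡ N (T r₂ C)
  N-along-straight {C} {r₁} r₂ C<n r₁≤r₂ r₂<n st =
    trans (sym (W-transposeTile (T r₁ C)))
      (trans (Transposed.W-along-straight r₂ C<n r₁≤r₂ r₂<n
                (λ r lo hi → straight-transposeTile (st r lo hi)))
        (W-transposeTile (T r₂ C)))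

  E≡true-right-straight : ∀ {R c} → R < n → c < n → (∀ c′ → c < c′ → c′ < n → Straight (T R c′)) →
                          E (T R c) ≡ true
  E≡true-right-straight {R} {c} R<n c<n st =
    trans (sym (S-transposeTile (T R c)))
      (Transposed.S≡true-below-straight c<n R<n (λ c′ lo hi → straight-transposeTile (st c′ lo hi)))

  straight-in-row : ∀ {i X} → i < n → (∀ c → c < n → c ≢ X → T i c ≢ rel) →
                    ∀ {c} → c < n → c ≢ X → Straight (T i c)
  straight-in-row {i} i<n rel-only-at-X {c} c<n c≢X =
    straight-transposeTile⁻ (T i c)
      (Transposed.straight-in-column i<n
        (λ c′ c′<n c′≢X e → rel-only-at-X c′ c′<n c′≢X (transposeTile-rel (T i c′) e)) c<n c≢X)

tileAt-fromℕ< : ∀ {n i j} (G : Grid n) (p : i < n) (q : j < n) → tileAt G i j ≡ G (fromℕ< p) (fromℕ< q)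
tileAt-fromℕ< {n} {i} {j} G p q with i <? n | j <? n
... | yes p′ | yes q′ = refl
... | no ¬p  | _      = contradiction p ¬p
... | yes _  | no ¬q  = contradiction q ¬q

tileAt-toℕ : ∀ {n} (G : Grid n) (i j : Fin n) → tileAt G (toℕ i) (toℕ j) ≡ G i j
tileAt-toℕ G i j = trans (tileAt-fromℕ< G (toℕ<n i) (toℕ<n j))
  (cong₂ G (fromℕ<-toℕ i (toℕ<n i)) (fromℕ<-toℕ j (toℕ<n j)))

tileAt-toℕˡ : ∀ {n j} (G : Grid n) (i : Fin n) (q : j < n) → tileAt G (toℕ i) j ≡ G i (fromℕ< q)
tileAt-toℕˡ G i q =
  trans (tileAt-fromℕ< G (toℕ<n i) q) (cong (λ i′ → G i′ _) (fromℕ<-toℕ i (toℕ<n i)))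

tileAt-toℕʳ : ∀ {n i} (G : Grid n) (p : i < n) (j : Fin n) → tileAt G i (toℕ j) ≡ G (fromℕ< p) j
tileAt-toℕʳ G p j = trans (tileAt-fromℕ< G p (toℕ<n j)) (cong (G _) (fromℕ<-toℕ j (toℕ<n j)))

isTiling : ∀ {n} (G : Grid n) → IsBPD n G → IsTiling n (tileAt G)
isTiling {n} G isBPD = record
  { east-west   = λ i j i<n j+1<n → trans (cong E (tileAt-fromℕ< G i<n (<-trans (n<1+n j) j+1<n)))
      (trans (horiz _ _ _ (trans (toℕ-fromℕ< j+1<n) (cong suc (sym (toℕ-fromℕ< _)))))
        (cong W (sym (tileAt-fromℕ< G i<n j+1<n))))
  ; south-north = λ i j i+1<n j<n → trans (cong S (tileAt-fromℕ< G (<-trans (n<1+n i) i+1<n) j<n))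
      (trans (vert _ _ _ (trans (toℕ-fromℕ< i+1<n) (cong suc (sym (toℕ-fromℕ< _)))))
        (cong N (sym (tileAt-fromℕ< G i+1<n j<n))))
  ; left-edge   = λ i i<n → trans (cong W (tileAt-fromℕ< G i<n (≤-<-trans z≤n i<n)))
      (left _ _ (toℕ-fromℕ< _))
  ; top-edge    = λ j j<n → trans (cong N (tileAt-fromℕ< G (≤-<-trans z≤n j<n) j<n))
      (top _ _ (toℕ-fromℕ< _))
  ; bottom-edge = λ i j e j<n → trans (cong S (tileAt-fromℕ< G (subst (i <_) e (n<1+n i)) j<n))
      (bottom _ _ (trans (cong suc (toℕ-fromℕ< _)) e))
  ; right-edge  = λ i j e i<n → trans (cong E (tileAt-fromℕ< G i<n (subst (j <_) e (n<1+n j))))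
      (right _ _ (trans (cong suc (toℕ-fromℕ< _)) e))
  }
  where open IsBPD isBPD

-- Following pipes

exitRow-unfold : ∀ {n n′} (G : Grid n) j → suc n′ ≡ n → exitRow G j ≡ follow G (2 * n + 1) n′ j true
exitRow-unfold G j refl = refl

fuel-suffices : ∀ {a m} b → a < m → a + m ≤ 2 * m + 1 + b
fuel-suffices {a} {m} b a<m =
  ≤-trans (+-monoˡ-≤ m (<⇒≤ a<m))
    (≤-trans (≤-reflexive (cong (m +_) (sym (+-identityʳ m))))
      (≤-trans (m≤m+n (2 * m) 1) (m≤m+n (2 * m + 1) b)))

nothing≢just : ∀ {y : ℕ} → nothing ≢ just y
nothing≢just ()

module Follow {n} (G : Grid n) where

  T : ℕ → ℕ → Tile
  T = tileAt G

  follow-stop : ∀ {f i j d y} → exitDir d (T i j) ≡ stop → follow G f i j d ≢ just y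
  follow-stop {zero}  _    ()
  follow-stop {suc f} halts eq rewrite halts = nothing≢just eq

  follow-north-top : ∀ {f j d y} → exitDir d (T 0 j) ≡ north → follow G f 0 j d ≢ just y
  follow-north-top {zero}  _     ()
  follow-north-top {suc f} goes-up eq rewrite goes-up = nothing≢just eq

  follow-north : ∀ {f i i⁻ j d} → exitDir d (T i j) ≡ north → i ≡ suc i⁻ →
                 follow G (suc f) i j d ≡ follow G f i⁻ j true
  follow-north goes-up refl rewrite goes-up = refl

  follow-east-last : ∀ {f i j d} → exitDir d (T i j) ≡ east → suc j ≡ n → follow G (suc f) i j d ≡ just i
  follow-east-last {j = j} goes-right last rewrite goes-right with suc j ≟ n
  ... | yes _    = refl
  ... | no ¬last = contradiction last ¬last

  follow-east : ∀ {f i j j⁺ d} → exitDir d (T i j) ≡ east → j⁺ ≡ suc j → j⁺ ≢ n →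
                follow G (suc f) i j d ≡ follow G f i j⁺ false
  follow-east {j = j} goes-right refl ¬last rewrite goes-right with suc j ≟ n
  ... | yes last = contradiction last ¬last
  ... | no _     = refl

  straight-continues : ∀ {f i j d y} → Straight (T i j) → follow G f i j d ≡ just y →
                       exitDir d (T i j) ≡ forward d
  straight-continues {f} {d = d} st eq with straight-exit st d
  ... | inj₁ fwd   = fwd
  ... | inj₂ halts = contradiction eq (follow-stop {f} halts)

  climb : ∀ f {R R′ c y} → R ≤ R′ → (∀ r → R < r → r ≤ R′ → Straight (T r c)) →
          follow G f R′ c true ≡ just y → ∃[ f′ ] follow G f′ R c true ≡ just y
  climb zero _ _ ()
  climb (suc f) R≤R′ st eq with m≤n⇒m<n∨m≡n R≤R′
  ... | inj₂ refl        = suc f , eq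
  ... | inj₁ (s≤s R≤R′⁻) =
    climb f R≤R′⁻ (λ r lo hi → st r lo (m≤n⇒m≤1+n hi))
      (trans (sym (follow-north (straight-continues (st _ (s≤s R≤R′⁻) ≤-refl) eq) refl)) eq)

  slide : ∀ f {R c c⁺ y} → c ≤ c⁺ → c⁺ < n → (∀ c′ → c ≤ c′ → c′ < c⁺ → Straight (T R c′)) →
          follow G f R c false ≡ just y → ∃[ f′ ] follow G f′ R c⁺ false ≡ just y
  slide zero _ _ _ ()
  slide (suc f) c≤c⁺ c⁺<n st eq with m≤n⇒m<n∨m≡n c≤c⁺
  ... | inj₂ refl = suc f , eq
  ... | inj₁ c<c⁺ =
    slide f c<c⁺ c⁺<n (λ c′ lo hi → st c′ (<⇒≤ lo) hi)
      (trans (sym (follow-east (straight-continues (st _ ≤-refl c<c⁺) eq) refl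
                     (<⇒≢ (≤-<-trans c<c⁺ c⁺<n)))) eq)

  north-to : ∀ {f R R⁻ c d y} → exitDir d (T R c) ≡ north → R⁻ < R →
             (∀ r → R⁻ < r → r < R → Straight (T r c)) →
             follow G f R c d ≡ just y → ∃[ f′ ] follow G f′ R⁻ c true ≡ just y
  north-to {zero}  _     _            _  ()
  north-to {suc f} goes-up (s≤s R⁻≤R) st eq =
    climb f R⁻≤R (λ r lo hi → st r lo (s≤s hi)) (trans (sym (follow-north goes-up refl)) eq)

  east-to : ∀ {f R c c⁺ d y} → exitDir d (T R c) ≡ east → c < c⁺ → c⁺ < n →
            (∀ c′ → c < c′ → c′ < c⁺ → Straight (T R c′)) →
            follow G f R c d ≡ just y → ∃[ f′ ] follow G f′ R c⁺ false ≡ just y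
  east-to {zero}  _    _     _    _  ()
  east-to {suc f} goes-right c<c⁺ c⁺<n st eq =
    slide f c<c⁺ c⁺<n st (trans (sym (follow-east goes-right refl (<⇒≢ (≤-<-trans c<c⁺ c⁺<n)))) eq)

  escape-top : ∀ f {R c d y} → exitDir d (T R c) ≡ north → (∀ r → r < R → Straight (T r c)) →
               follow G f R c d ≢ just y
  escape-top zero                _       _  ()
  escape-top (suc f) {zero}      goes-up _  eq = follow-north-top goes-up eq
  escape-top (suc f) {suc R} {c} {y = y} goes-up st eq =
    escape-top f (straight-continues {f} (st R ≤-refl) eq′) (λ r r<R → st r (m<n⇒m<1+n r<R)) eq′
    where
    eq′ : follow G f R c true ≡ just y
    eq′ = trans (sym (follow-north {f} goes-up refl)) eq

  exit-right : ∀ f {R c d y} → c < n → exitDir d (T R c) ≡ east →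
               (∀ c′ → c < c′ → c′ < n → Straight (T R c′)) → follow G f R c d ≡ just y → y ≡ R
  exit-right zero _ _ _ ()
  exit-right (suc f) {R} {c} {y = y} c<n goes-right st eq with suc c ≟ n
  ... | yes last = sym (just-injective (trans (sym (follow-east-last goes-right last)) eq))
  ... | no ¬last =
    exit-right f c+1<n (straight-continues {f} (st (suc c) ≤-refl c+1<n) eq′)
      (λ c′ lo hi → st c′ (<-trans (n<1+n c) lo) hi) eq′
    where
    c+1<n : suc c < n
    c+1<n = ≤∧≢⇒< c<n ¬last
    eq′ : follow G f R (suc c) false ≡ just y
    eq′ = trans (sym (follow-east {f} goes-right refl ¬last)) eq

-- Strictly increasing maps and their images

NotInImage : ∀ {m n} → (Fin m → Fin n) → ℕ → Set
NotInImage f r = ∀ k → toℕ (f k) ≢ r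

module _ {m n} {f : Fin m → Fin n} (f-inc : StrictlyIncreasing f) where

  strictlyIncreasing-reflects-< : ∀ a b → toℕ (f a) < toℕ (f b) → toℕ a < toℕ b
  strictlyIncreasing-reflects-< a b fa<fb with <-cmp (toℕ a) (toℕ b)
  ... | tri< a<b _ _ = a<b
  ... | tri≈ _ a≡b _ = contradiction (cong (toℕ ∘ f) (toℕ-injective a≡b)) (<⇒≢ fa<fb)
  ... | tri> _ _ b<a = contradiction (f-inc b a b<a) (<-asym fa<fb)

  strictlyIncreasing⇒injective : Injective _≡_ _≡_ f
  strictlyIncreasing⇒injective {a} {b} fa≡fb with <-cmp (toℕ a) (toℕ b)
  ... | tri< a<b _ _ = contradiction (cong toℕ fa≡fb) (<⇒≢ (f-inc a b a<b))
  ... | tri≈ _ a≡b _ = toℕ-injective a≡b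
  ... | tri> _ _ b<a = contradiction (cong toℕ fa≡fb) (>⇒≢ (f-inc b a b<a))

  ∉-image-between : ∀ a a′ {r} → toℕ a′ ≡ suc (toℕ a) → toℕ (f a) < r → r < toℕ (f a′) →
                    NotInImage f r
  ∉-image-between a a′ a′≡1+a lo hi k refl =
    <-irrefl refl (<-≤-trans (strictlyIncreasing-reflects-< k a′ hi)
      (subst (_≤ toℕ k) (sym a′≡1+a) (strictlyIncreasing-reflects-< a k lo)))

  ∉-image-below : ∀ a {r} → toℕ a ≡ 0 → r < toℕ (f a) → NotInImage f r
  ∉-image-below a a≡0 hi k refl =
    n≮0 (subst (toℕ k <_) a≡0 (strictlyIncreasing-reflects-< k a hi))

  ∉-image-above : ∀ a {r} → suc (toℕ a) ≡ m → toℕ (f a) < r → NotInImage f r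
  ∉-image-above a a+1≡m lo k refl =
    <-irrefl refl (<-≤-trans (toℕ<n k)
      (subst (_≤ toℕ k) a+1≡m (strictlyIncreasing-reflects-< a k lo)))

first-or-previous : ∀ {m} (a : Fin m) → toℕ a ≡ 0 ⊎ Σ[ a⁻ ∈ Fin m ] toℕ a ≡ suc (toℕ a⁻)
first-or-previous          zero    = inj₁ refl
first-or-previous {suc m} (suc a) = inj₂ (inject₁ a , cong suc (sym (toℕ-inject₁ a)))

last-or-next : ∀ {m} (b : Fin m) → suc (toℕ b) ≡ m ⊎ Σ[ b⁺ ∈ Fin m ] toℕ b⁺ ≡ suc (toℕ b)
last-or-next {m} b with suc (toℕ b) ≟ m
... | yes last = inj₁ last
... | no ¬last = inj₂ (fromℕ< (≤∧≢⇒< (toℕ<n b) ¬last) , toℕ-fromℕ< _)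

lastIndex : ∀ {n} → Fin n → Σ[ l ∈ Fin n ] suc (toℕ l) ≡ n
lastIndex {suc n} _ = fromℕ n , cong suc (toℕ-fromℕ n)

injective⇒surjective : ∀ {n} {f : Fin n → Fin n} → Injective _≡_ _≡_ f → ∀ y → ∃[ x ] f x ≡ y
injective⇒surjective {zero}          _     ()
injective⇒surjective {suc n} {f = f} f-inj y with any? (λ x → f x ≟ᶠ y)
... | yes hit = hit
... | no miss = contradiction (injective⇒≤ punchOut-f-injective) 1+n≰n
  where
  y≢f : ∀ x → y ≢ f x
  y≢f x y≡fx = miss (x , sym y≡fx)
  punchOut-f-injective : Injective _≡_ _≡_ (λ x → punchOut (y≢f x))
  punchOut-f-injective eq = f-inj (punchOut-injective (y≢f _) (y≢f _) eq)

-- Counting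

indicator : ∀ {p} {P : Set p} → Dec P → ℕ
indicator p? = if does p? then 1 else 0

indicator-cong : ∀ {p q} {P : Set p} {Q : Set q} → (P → Q) → (Q → P) →
                 (p? : Dec P) (q? : Dec Q) → indicator p? ≡ indicator q?
indicator-cong _   _   (yes _) (yes _) = refl
indicator-cong P→Q _   (yes p) (no ¬q) = contradiction (P→Q p) ¬q
indicator-cong _   Q→P (no ¬p) (yes q) = contradiction (Q→P q) ¬p
indicator-cong _   _   (no _)  (no _)  = refl

length-filter-tabulate : ∀ {a p} {A : Set a} {P : A → Set p} (P? : Decidable P) {m} (f : Fin m → A) →
                         length (filter P? (tabulate f)) ≡ sum (λ i → indicator (P? (f i)))
length-filter-tabulate P? {zero}  f = refl
length-filter-tabulate P? {suc m} f with P? (f zero)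
... | yes _ = cong suc (length-filter-tabulate P? (f ∘ suc))
... | no _  = length-filter-tabulate P? (f ∘ suc)

sum-indicator-< : ∀ {m} J → J ≤ m → sum {m} (λ l → indicator (toℕ l <? J)) ≡ J
sum-indicator-< {m} zero _         = sum-replicate-zero m
sum-indicator-< (suc J) (s≤s J≤m) = cong suc (sum-indicator-< J J≤m)

count-below-permutation : ∀ {m} (π : Permutation′ m) J → J ≤ m →
                          sum (λ l → indicator (toℕ (π ⟨$⟩ʳ l) <? J)) ≡ J
count-below-permutation π J J≤m =
  trans (sym (sum-permute (λ l → indicator (toℕ l <? J)) π)) (sum-indicator-< J J≤m)

-- Erasing the removable pipes

Removable-respects : ∀ {n} {G : Grid n} {u v : Fin n → Fin n} {i} → u i ≡ v i →
                     Removable G u i → Removable G v i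
Removable-respects {G = G} {i = i} =
  subst (λ j → G i j ≡ rel × (∀ j′ → G i j′ ≡ rel → j′ ≡ j) × (∀ i′ → G i′ j ≡ rel → i′ ≡ i))

module Deletion {m n} (w : Fin n → Fin n) (w-inj : Injective _≡_ _≡_ w)
                (s t : Fin m → Fin n) (s-inc : StrictlyIncreasing s) (t-inc : StrictlyIncreasing t)
                (t⊆v : ∀ l → ∃[ k ] t l ≡ w (s k)) (v⊆t : ∀ k → ∃[ l ] w (s k) ≡ t l)
                (B : Grid n) (B∈BPDsub : InBPDsub w s B) where

  C : Grid m
  C = φ s t B

  T : ℕ → ℕ → Tile
  T = tileAt B

  B-isTiling : IsTiling n T
  B-isTiling = isTiling B (proj₁ (proj₁ B∈BPDsub))

  open IsTiling B-isTiling
  open Tiling B-isTiling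
  module FB = Follow B
  module FC = Follow C

  Deleted : Fin n → Set
  Deleted x = ∀ k → s k ≢ x

  deleted⇒removable : ∀ {x} → Deleted x → Removable B w x
  deleted⇒removable {x} = Equivalence.from (proj₂ B∈BPDsub x)

  kept⇒¬removable : ∀ k → ¬ Removable B w (s k)
  kept⇒¬removable k removable = Equivalence.to (proj₂ B∈BPDsub (s k)) removable k refl

  σ : Fin m → Fin m
  σ k = proj₁ (v⊆t k)

  t∘σ : ∀ k → t (σ k) ≡ w (s k)
  t∘σ k = sym (proj₂ (v⊆t k))

  σ-permutation : Permutation′ m
  σ-permutation = permutation σ τ σ∘τ τ∘σ
    where
    τ : Fin m → Fin m
    τ l = proj₁ (t⊆v l)
    σ∘τ : ∀ l → σ (τ l) ≡ l
    σ∘τ l = strictlyIncreasing⇒injective t-inc (trans (t∘σ (τ l)) (sym (proj₂ (t⊆v l))))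
    τ∘σ : ∀ k → τ (σ k) ≡ k
    τ∘σ k = strictlyIncreasing⇒injective s-inc (w-inj (trans (sym (proj₂ (t⊆v (σ k)))) (t∘σ k)))

  preimage-deleted : ∀ {x j} → w x ≡ j → (∀ l → t l ≢ j) → Deleted x
  preimage-deleted wx≡j j∉t k refl = j∉t (σ k) (trans (t∘σ k) wx≡j)

  rel-only-in-row : ∀ {x} → Removable B w x → ∀ c → c < n → c ≢ toℕ (w x) → T (toℕ x) c ≢ rel
  rel-only-in-row {x} (_ , unique , _) c c<n c≢wx T≡rel =
    c≢wx (trans (sym (toℕ-fromℕ< c<n))
      (cong toℕ (unique (fromℕ< c<n) (trans (sym (tileAt-toℕˡ B x c<n)) T≡rel))))

  rel-only-in-column : ∀ {x} → Removable B w x → ∀ r → r < n → r ≢ toℕ x → T r (toℕ (w x)) ≢ rel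
  rel-only-in-column {x} (_ , _ , unique) r r<n r≢x T≡rel =
    r≢x (trans (sym (toℕ-fromℕ< r<n))
      (cong toℕ (unique (fromℕ< r<n) (trans (sym (tileAt-toℕʳ B r<n (w x))) T≡rel))))

  straight-in-kept-column : ∀ b {r} → r < n → NotInImage s r → Straight (T r (toℕ (t b)))
  straight-in-kept-column b {r} r<n r∉s =
    subst (λ i → Straight (T i (toℕ (t b)))) (toℕ-fromℕ< r<n)
      (straight-in-row (toℕ<n x) (rel-only-in-row (deleted⇒removable x-deleted)) (toℕ<n (t b)) tb≢wx)
    where
    x : Fin n
    x = fromℕ< r<n
    x-deleted : Deleted x
    x-deleted k sk≡x = r∉s k (trans (cong toℕ sk≡x) (toℕ-fromℕ< r<n))
    tb≢wx : toℕ (t b) ≢ toℕ (w x)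
    tb≢wx tb≡wx = x-deleted (proj₁ (t⊆v b))
      (w-inj (trans (sym (proj₂ (t⊆v b))) (toℕ-injective tb≡wx)))

  straight-in-kept-row : ∀ a {c} → c < n → NotInImage t c → Straight (T (toℕ (s a)) c)
  straight-in-kept-row a {c} c<n c∉t =
    subst (Straight ∘ T (toℕ (s a))) wx≡c
      (straight-in-column (toℕ<n (w x)) (rel-only-in-column (deleted⇒removable x-deleted))
        (toℕ<n (s a)) (λ sa≡x → x-deleted a (toℕ-injective sa≡x)))
    where
    x : Fin n
    x = proj₁ (injective⇒surjective w-inj (fromℕ< c<n))
    wx≡c : toℕ (w x) ≡ c
    wx≡c = trans (cong toℕ (proj₂ (injective⇒surjective w-inj (fromℕ< c<n)))) (toℕ-fromℕ< c<n)
    x-deleted : Deleted x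
    x-deleted = preimage-deleted refl (λ l tl≡wx → c∉t l (trans (cong toℕ tl≡wx) wx≡c))

  C-tile : ∀ i j → C i j ≡ T (toℕ (s i)) (toℕ (t j))
  C-tile i j = sym (tileAt-toℕ B (s i) (t j))

  C-east-west : ∀ i j j′ → toℕ j′ ≡ suc (toℕ j) → E (C i j) ≡ W (C i j′)
  C-east-west i j j′ j′≡1+j = begin
    E (C i j)                  ≡⟨ cong E (C-tile i j) ⟩
    E (T R (toℕ (t j)))        ≡⟨ east-west R _ R<n (≤-<-trans tj<tj′ (toℕ<n (t j′))) ⟩
    W (T R (suc (toℕ (t j))))  ≡⟨ W-along-straight _ R<n tj<tj′ (toℕ<n (t j′)) (λ c lo hi →
                                    straight-in-kept-row i (<-trans hi (toℕ<n (t j′)))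
                                      (∉-image-between t-inc j j′ j′≡1+j lo hi)) ⟩
    W (T R (toℕ (t j′)))       ≡⟨ cong W (C-tile i j′) ⟨
    W (C i j′)                 ∎
    where
    open ≡-Reasoning
    R : ℕ
    R = toℕ (s i)
    R<n : R < n
    R<n = toℕ<n (s i)
    tj<tj′ : toℕ (t j) < toℕ (t j′)
    tj<tj′ = t-inc j j′ (≤-reflexive (sym j′≡1+j))

  C-south-north : ∀ i i′ j → toℕ i′ ≡ suc (toℕ i) → S (C i j) ≡ N (C i′ j)
  C-south-north i i′ j i′≡1+i = begin
    S (C i j)                  ≡⟨ cong S (C-tile i j) ⟩
    S (T (toℕ (s i)) c)        ≡⟨ south-north _ c (≤-<-trans si<si′ (toℕ<n (s i′))) c<n ⟩
    N (T (suc (toℕ (s i))) c)  ≡⟨ N-along-straight _ c<n si<si′ (toℕ<n (s i′)) (λ r lo hi →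
                                    straight-in-kept-column j (<-trans hi (toℕ<n (s i′)))
                                      (∉-image-between s-inc i i′ i′≡1+i lo hi)) ⟩
    N (T (toℕ (s i′)) c)       ≡⟨ cong N (C-tile i′ j) ⟨
    N (C i′ j)                 ∎
    where
    open ≡-Reasoning
    c : ℕ
    c = toℕ (t j)
    c<n : c < n
    c<n = toℕ<n (t j)
    si<si′ : toℕ (s i) < toℕ (s i′)
    si<si′ = s-inc i i′ (≤-reflexive (sym i′≡1+i))

  C-left : ∀ i j → toℕ j ≡ 0 → W (C i j) ≡ false
  C-left i j j≡0 =
    trans (cong W (C-tile i j))
      (trans (sym (W-along-straight _ (toℕ<n (s i)) z≤n (toℕ<n (t j)) (λ c _ hi →
                straight-in-kept-row i (<-trans hi (toℕ<n (t j))) (∉-image-below t-inc j j≡0 hi))))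
        (left-edge _ (toℕ<n (s i))))

  C-top : ∀ i j → toℕ i ≡ 0 → N (C i j) ≡ false
  C-top i j i≡0 =
    trans (cong N (C-tile i j))
      (trans (sym (N-along-straight _ (toℕ<n (t j)) z≤n (toℕ<n (s i)) (λ r _ hi →
                straight-in-kept-column j (<-trans hi (toℕ<n (s i))) (∉-image-below s-inc i i≡0 hi))))
        (top-edge _ (toℕ<n (t j))))

  C-bottom : ∀ i j → suc (toℕ i) ≡ m → S (C i j) ≡ true
  C-bottom i j i+1≡m =
    trans (cong S (C-tile i j))
      (S≡true-below-straight (toℕ<n (s i)) (toℕ<n (t j)) (λ r lo hi →
        straight-in-kept-column j hi (∉-image-above s-inc i i+1≡m lo)))

  C-right : ∀ i j → suc (toℕ j) ≡ m → E (C i j) ≡ true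
  C-right i j j+1≡m =
    trans (cong E (C-tile i j))
      (E≡true-right-straight (toℕ<n (s i)) (toℕ<n (t j)) (λ c lo hi →
        straight-in-kept-row i hi (∉-image-above t-inc j j+1≡m lo)))

  φ-isBPD : IsBPD m C
  φ-isBPD = record
    { horiz = C-east-west ; vert = C-south-north ; left = C-left
    ; top = C-top ; bottom = C-bottom ; right = C-right }

  B-exit : ∀ {a b d dir} → exitDir d (C a b) ≡ dir → exitDir d (T (toℕ (s a)) (toℕ (t b))) ≡ dir
  B-exit {a} {b} {d} = trans (cong (exitDir d) (tileAt-toℕ B (s a) (t b)))

  C-exit : ∀ {a b d dir} → exitDir d (C a b) ≡ dir → exitDir d (FC.T (toℕ a) (toℕ b)) ≡ dir
  C-exit {a} {b} {d} = trans (cong (exitDir d) (tileAt-toℕ C a b))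

  ExitsInC : ℕ → Fin m → Fin m → Bool → ℕ → Set
  ExitsInC g a b d y = ∃[ r ] follow C g (toℕ a) (toℕ b) d ≡ just (toℕ r) × y ≡ toℕ (s r)

  -- Each step of a pipe in C lowers the row or raises the column; the fuel bound records this.
  follow-φ : ∀ g f a b d {y} → toℕ a + m ≤ g + toℕ b →
             follow B f (toℕ (s a)) (toℕ (t b)) d ≡ just y → ExitsInC g a b d y

  follow-φ-north : ∀ g f a b d {y} → exitDir d (C a b) ≡ north → toℕ a + m ≤ suc g + toℕ b →
                   follow B f (toℕ (s a)) (toℕ (t b)) d ≡ just y → ExitsInC (suc g) a b d y
  follow-φ-north g f a b d up fuel eq with first-or-previous a
  ... | inj₁ a≡0 = ⊥-elim (FB.escape-top f (B-exit up) (λ r r<R →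
          straight-in-kept-column b (<-trans r<R (toℕ<n (s a))) (∉-image-below s-inc a a≡0 r<R)) eq)
  ... | inj₂ (a⁻ , a≡1+a⁻) =
    let (f′ , eq′)       = FB.north-to {f} (B-exit up) (s-inc a⁻ a (≤-reflexive (sym a≡1+a⁻))) between eq
        (r , eqC , y≡sr) = follow-φ g f′ a⁻ b true fuel′ eq′
    in r , trans (FC.follow-north {g} (C-exit up) a≡1+a⁻) eqC , y≡sr
    where
    between : ∀ r → toℕ (s a⁻) < r → r < toℕ (s a) → Straight (T r (toℕ (t b)))
    between r lo hi =
      straight-in-kept-column b (<-trans hi (toℕ<n (s a))) (∉-image-between s-inc a⁻ a a≡1+a⁻ lo hi)
    fuel′ : toℕ a⁻ + m ≤ g + toℕ b
    fuel′ = ≤-pred (subst (λ i → i + m ≤ suc g + toℕ b) a≡1+a⁻ fuel)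

  follow-φ-east : ∀ g f a b d {y} → exitDir d (C a b) ≡ east → toℕ a + m ≤ suc g + toℕ b →
                  follow B f (toℕ (s a)) (toℕ (t b)) d ≡ just y → ExitsInC (suc g) a b d y
  follow-φ-east g f a b d right fuel eq with last-or-next b
  ... | inj₁ last = a , FC.follow-east-last {g} (C-exit right) last ,
          FB.exit-right f (toℕ<n (t b)) (B-exit right) (λ c lo hi →
            straight-in-kept-row a hi (∉-image-above t-inc b last lo)) eq
  ... | inj₂ (b⁺ , b⁺≡1+b) =
    let (f′ , eq′)       = FB.east-to {f} (B-exit right) (t-inc b b⁺ (≤-reflexive (sym b⁺≡1+b)))
                             (toℕ<n (t b⁺)) between eq
        (r , eqC , y≡sr) = follow-φ g f′ a b⁺ false fuel′ eq′
    in r , trans (FC.follow-east {g} (C-exit right) b⁺≡1+b (<⇒≢ (toℕ<n b⁺))) eqC , y≡sr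
    where
    between : ∀ c → toℕ (t b) < c → c < toℕ (t b⁺) → Straight (T (toℕ (s a)) c)
    between c lo hi =
      straight-in-kept-row a (<-trans hi (toℕ<n (t b⁺))) (∉-image-between t-inc b b⁺ b⁺≡1+b lo hi)
    fuel′ : toℕ a + m ≤ g + toℕ b⁺
    fuel′ = ≤-trans fuel (≤-reflexive (trans (sym (+-suc g (toℕ b))) (cong (g +_) (sym b⁺≡1+b))))

  follow-φ zero    _ a b _ fuel _ =
    ⊥-elim (<-irrefl refl (<-≤-trans (toℕ<n b) (≤-trans (m≤n+m m (toℕ a)) fuel)))
  follow-φ (suc g) f a b d fuel eq with exitDir d (C a b) in ex
  ... | stop  = contradiction eq (FB.follow-stop {f} (B-exit ex))
  ... | north = follow-φ-north g f a b d ex fuel eq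
  ... | east  = follow-φ-east g f a b d ex fuel eq

  φ-hasPerm : HasPerm C σ
  φ-hasPerm i with lastIndex i | lastIndex (s i)
  ... | aL , aL-last | nL , nL-last =
    let (f′ , eq′)        = FB.climb (2 * n + 1) saL≤nL above-last-kept B-pipe
        (r , eqC , si≡sr) = follow-φ (2 * m + 1) f′ aL (σ i) true (fuel-suffices _ (toℕ<n aL)) eq′
    in begin
      exitRow C (toℕ (σ i))                           ≡⟨ exitRow-unfold C (toℕ (σ i)) aL-last ⟩
      follow C (2 * m + 1) (toℕ aL) (toℕ (σ i)) true  ≡⟨ eqC ⟩
      just (toℕ r)                                    ≡⟨ cong (just ∘ toℕ)
                                                           (strictlyIncreasing⇒injective s-inc
                                                             (toℕ-injective si≡sr)) ⟨
      just (toℕ i)                                    ∎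
    where
    open ≡-Reasoning
    c : ℕ
    c = toℕ (t (σ i))
    B-pipe : follow B (2 * n + 1) (toℕ nL) c true ≡ just (toℕ (s i))
    B-pipe = trans (sym (exitRow-unfold B c nL-last))
      (subst (λ j → exitRow B (toℕ j) ≡ just (toℕ (s i))) (sym (t∘σ i)) (proj₂ (proj₁ B∈BPDsub) (s i)))
    saL≤nL : toℕ (s aL) ≤ toℕ nL
    saL≤nL = ≤-pred (subst (toℕ (s aL) <_) (sym nL-last) (toℕ<n (s aL)))
    above-last-kept : ∀ r → toℕ (s aL) < r → r ≤ toℕ nL → Straight (T r c)
    above-last-kept r lo hi =
      straight-in-kept-column (σ i) (≤-<-trans hi (toℕ<n nL)) (∉-image-above s-inc aL aL-last lo)

  rank≡σ : ∀ k → rank (λ l → toℕ (w (s l))) k ≡ toℕ (σ k)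
  rank≡σ k = begin
    rank v k                                        ≡⟨ length-filter-tabulate (λ l → v l <? v k) id ⟩
    sum (λ l → indicator (v l <? v k))              ≡⟨ sum-cong-≗ same-indicator ⟩
    sum (λ l → indicator (toℕ (σ l) <? toℕ (σ k)))  ≡⟨ count-below-permutation σ-permutation
                                                         (toℕ (σ k)) (<⇒≤ (toℕ<n (σ k))) ⟩
    toℕ (σ k)                                       ∎
    where
    open ≡-Reasoning
    v : Fin m → ℕ
    v l = toℕ (w (s l))
    v≡tσ : ∀ l → v l ≡ toℕ (t (σ l))
    v≡tσ l = cong toℕ (sym (t∘σ l))
    same-indicator : ∀ l → indicator (v l <? v k) ≡ indicator (toℕ (σ l) <? toℕ (σ k))
    same-indicator l = indicator-cong
      (λ lt → strictlyIncreasing-reflects-< t-inc (σ l) (σ k) (subst₂ _<_ (v≡tσ l) (v≡tσ k) lt))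
      (λ lt → subst₂ _<_ (sym (v≡tσ l)) (sym (v≡tσ k)) (t-inc (σ l) (σ k) lt))
      (v l <? v k) (toℕ (σ l) <? toℕ (σ k))

  φ-minimal : ∀ i → ¬ Removable C σ i
  φ-minimal i (C-rel , C-row-unique , C-column-unique) =
    kept⇒¬removable i (subst (λ j → B (s i) j ≡ rel) (t∘σ i) C-rel , B-row-unique , B-column-unique)
    where
    B-row-unique : ∀ j → B (s i) j ≡ rel → j ≡ w (s i)
    B-row-unique j B≡rel with any? (λ l → t l ≟ᶠ j) | injective⇒surjective w-inj j
    ... | yes (l , refl) | _        = trans (cong t (C-row-unique l B≡rel)) (t∘σ i)
    ... | no j∉t         | x , refl =
      ⊥-elim (x-deleted i (proj₂ (proj₂ (deleted⇒removable x-deleted)) (s i) B≡rel))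
      where
      x-deleted : Deleted x
      x-deleted = preimage-deleted refl (λ l tl≡wx → j∉t (l , tl≡wx))

    B-column-unique : ∀ i′ → B i′ (w (s i)) ≡ rel → i′ ≡ s i
    B-column-unique i′ B≡rel with any? (λ k → s k ≟ᶠ i′)
    ... | yes (k , refl) = cong s (C-column-unique k (subst (λ c → B (s k) c ≡ rel) (sym (t∘σ i)) B≡rel))
    ... | no i′∉s        =
      ⊥-elim (i′∉s (i , w-inj (proj₁ (proj₂ (deleted⇒removable i′-deleted)) (w (s i)) B≡rel)))
      where
      i′-deleted : Deleted i′
      i′-deleted k sk≡i′ = i′∉s (k , sk≡i′)

mainTheorem1 : ∀ {m n} (w : Fin n → Fin n) → Injective _≡_ _≡_ w
    → (s t : Fin m → Fin n) → StrictlyIncreasing s → StrictlyIncreasing t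
    → (∀ l → ∃[ k ] t l ≡ w (s k)) → (∀ k → ∃[ l ] w (s k) ≡ t l)
    → (u : Fin m → Fin m) → IsPermOf (λ k → toℕ (w (s k))) u
    → (B : Grid n) → InBPDsub w s B
    → InMBPD u (φ s t B)
mainTheorem1 w w-inj s t s-inc t-inc t⊆v v⊆t u u-perm B B∈BPDsub =
  (φ-isBPD , λ i → subst (λ j → exitRow C (toℕ j) ≡ just (toℕ i)) (sym (u≡σ i)) (φ-hasPerm i)) ,
  λ i → φ-minimal i ∘ Removable-respects {G = C} {u} {σ} (u≡σ i)
  where
  open Deletion w w-inj s t s-inc t-inc t⊆v v⊆t B B∈BPDsub
  u≡σ : ∀ k → u k ≡ σ k
  u≡σ k = toℕ-injective (trans (u-perm k) (rank≡σ k))
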